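{- Let $G$ be a connected graph of order $n_1\ge2$ and $H$ a disconnected graph of order $n_2\ge2$, and let $k\ge1$ be an integer. Then $$Z(G\odot^{k}H)=n_1(n_2+1)^{k-1}Z(K_1\odot H)=n_1(n_2+1)^{k-1}(n_2-1)$$ if and only if $H\cong\overline{K_{n_2}}$ (the edgeless graph on $n_2$ vertices).
   Context: Zero forcing: given a set $S$ of initially black vertices (others white), the color-change rule turns a white vertex black if it is the only white neighbor of some black vertex; $S$ is a zero forcing set if eventually all vertices become black; $Z(G)$ is the minimum size of a zero forcing set. Corona: for $G$ of order $n_1$, $G\odot H$ is obtained from $G$ and $n_1$ disjoint copies of $H$ by joining the $i$-th vertex of $G$ to every vertex of the $i$-th copy; $G\odot^1H=G\odot H$, $G\odot^kH=(G\odot^{k-1}H)\odot H$. $K_1\odot H$ is the join of one vertex with $H$. -}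

module Defs where

open import Data.Nat using (ℕ; zero; suc; _+_; _*_)
open import Data.Fin using (Fin; splitAt; remQuot)
open import Data.Fin.Subset using (Subset; _∈_; _∉_; _∪_; ⁅_⁆; ⊤; ∣_∣)
open import Data.Product using (Σ; _×_; _,_; ∃-syntax)
open import Data.Sum using (_⊎_; inj₁; inj₂)
open import Data.Empty using (⊥)
open import Relation.Nullary using (¬_)
open import Relation.Binary.PropositionalEquality using (_≡_; _≢_; sym)
open import Relation.Binary.Construct.Closure.ReflexiveTransitive using (Star)
open import Function.Bundles using (_↔_; Inverse)
open import Level using (0ℓ)

record Graph (n : ℕ) : Set₁ where
  field
    Adj    : Fin n → Fin n → Set
    sym'   : ∀ {i j} → Adj i j → Adj j i
    irrefl : ∀ {i} → ¬ Adj i i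
open Graph public

data Walk {n} (G : Graph n) : Fin n → Fin n → Set where
  here : ∀ {i} → Walk G i i
  step : ∀ {i j k} → Adj G i j → Walk G j k → Walk G i k

Connected : ∀ {n} → Graph n → Set
Connected G = ∀ i j → Walk G i j

Disconnected : ∀ {n} → Graph n → Set
Disconnected G = ¬ Connected G

_≅_ : ∀ {n} → Graph n → Graph n → Set
_≅_ {n} G H = Σ (Fin n ↔ Fin n) λ f →
  ∀ i j → (Adj G i j → Adj H (Inverse.to f i) (Inverse.to f j))
        × (Adj H (Inverse.to f i) (Inverse.to f j) → Adj G i j)

edgeless : (n : ℕ) → Graph n
edgeless n = record { Adj = λ _ _ → ⊥ ; sym' = λ () ; irrefl = λ () }

K₁ : Graph 1
K₁ = edgeless 1

-- Corona G ⊙ H.  Vertex set Fin (n₁ + n₁ * n₂): the first n₁ vertices are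
-- those of G; vertex (c , h) of the second block (via remQuot) is vertex h of
-- the c-th copy of H.
private
  V : ℕ → ℕ → Set
  V n₁ n₂ = Fin n₁ ⊎ (Fin n₁ × Fin n₂)

  dec : ∀ n₁ n₂ → Fin (n₁ + n₁ * n₂) → V n₁ n₂
  dec n₁ n₂ x with splitAt n₁ x
  ... | inj₁ i = inj₁ i
  ... | inj₂ p = inj₂ (remQuot n₂ p)

  AdjC : ∀ {n₁ n₂} → Graph n₁ → Graph n₂ → V n₁ n₂ → V n₁ n₂ → Set
  AdjC G H (inj₁ i) (inj₁ j) = Adj G i j
  AdjC G H (inj₁ i) (inj₂ (c , h)) = i ≡ c
  AdjC G H (inj₂ (c , h)) (inj₁ j) = c ≡ j
  AdjC G H (inj₂ (c , h)) (inj₂ (d , h')) = (c ≡ d) × Adj H h h'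

  symC : ∀ {n₁ n₂} (G : Graph n₁) (H : Graph n₂) x y → AdjC G H x y → AdjC G H y x
  symC G H (inj₁ i) (inj₁ j) a = sym' G a
  symC G H (inj₁ i) (inj₂ _) e = sym e
  symC G H (inj₂ _) (inj₁ j) e = sym e
  symC G H (inj₂ _) (inj₂ _) (e , a) = sym e , sym' H a

  irrC : ∀ {n₁ n₂} (G : Graph n₁) (H : Graph n₂) x → ¬ AdjC G H x x
  irrC G H (inj₁ i) a = irrefl G a
  irrC G H (inj₂ _) (_ , a) = irrefl H a

_⊙_ : ∀ {n₁ n₂} → Graph n₁ → Graph n₂ → Graph (n₁ + n₁ * n₂)
_⊙_ {n₁} {n₂} G H = record
  { Adj = λ x y → AdjC G H (dec n₁ n₂ x) (dec n₁ n₂ y)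
  ; sym' = λ {x} {y} → symC G H (dec n₁ n₂ x) (dec n₁ n₂ y)
  ; irrefl = λ {x} → irrC G H (dec n₁ n₂ x)
  }

coronaOrder : ℕ → ℕ → ℕ → ℕ
coronaOrder n₁ n₂ zero = n₁
coronaOrder n₁ n₂ (suc k) = coronaOrder n₁ n₂ k + coronaOrder n₁ n₂ k * n₂

_⊙^_∙_ : ∀ {n₁ n₂} → Graph n₁ → (k : ℕ) → Graph n₂ → Graph (coronaOrder n₁ n₂ k)
G ⊙^ zero ∙ H = G
G ⊙^ suc k ∙ H = (G ⊙^ k ∙ H) ⊙ H

ForceStep : ∀ {n} → Graph n → Subset n → Subset n → Set
ForceStep G T T' = ∃[ v ] ∃[ w ]
  (v ∈ T × w ∉ T × Adj G v w
   × (∀ u → Adj G v u → u ≢ w → u ∈ T)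
   × T' ≡ T ∪ ⁅ w ⁆)

IsZeroForcingSet : ∀ {n} → Graph n → Subset n → Set
IsZeroForcingSet G S = Star (ForceStep G) S ⊤

IsZ : ∀ {n} → Graph n → ℕ → Set
IsZ G m = (∃[ S ] (IsZeroForcingSet G S × ∣ S ∣ ≡ m))
        × (∀ S → IsZeroForcingSet G S → m Data.Nat.≤ ∣ S ∣)

module Submission where

-- Since G ⊙^k H = B ⊙ H for B = G ⊙^(k-1) H, a graph with N = n₁ (n₂ + 1)^(k-1)
-- vertices and (as G is connected with n₁ ≥ 2) at least one edge, the theorem
-- reduces to: for disconnected H on n₂ ≥ 2 vertices, Z(B ⊙ H) = N (n₂ ∸ 1) iff
-- H is edgeless.  Both directions are proved by explicit forcing arguments.
-- * H edgeless: a leaf is adjacent only to its centre, so a leaf is forced only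
--   while it is the last white leaf of its copy.  Running a forcing process
--   backwards, every zero forcing set leaves at most one white leaf per copy,
--   so Z ≥ N (n₂ ∸ 1); all leaves but one per copy attain this bound.
-- * H with an edge a b: being disconnected, H has a vertex y ≠ a not adjacent
--   to a (obtained in double-negated form, as adjacency is not decidable).
--   Using an edge p q of B, the copy at q can do with n₂ ∸ 2 black leaves,
--   so Z(B ⊙ H) < N (n₂ ∸ 1).
-- The value Z(K₁ ⊙ H) = n₂ ∸ 1 is the edgeless bound for B = K₁.

open import Defs
open import Data.Nat using (ℕ; zero; suc; _+_; _*_; _^_; _∸_; _≤_; _<_; z≤n; s≤s)
open import Data.Nat.Properties using (+-mono-≤; +-mono-<-≤; +-mono-≤-<; ≤-trans; m∸n≤m; m≤n+m; ≤-reflexive; ≤-antisym; <⇒≤; *-identityˡ; *-identityʳ; *-suc; <⇒≱; *-assoc; *-comm; module ≤-Reasoning)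
open import Data.Bool using (true; false)
open import Data.Product using (_×_; _,_; proj₁; proj₂; ∃-syntax)
open import Data.Sum using (_⊎_; inj₁; inj₂)
open import Data.Vec using (Vec; []; _∷_; _++_; concat; map; sum; lookup; replicate; _[_]≔_)
open import Data.Vec.Properties using (lookup-++ʳ; lookup-replicate; lookup∘update; lookup∘update′; lookup-concat; []=⇒lookup; lookup⇒[]=)
open import Data.Fin using (Fin; zero; suc; _↑ˡ_; _↑ʳ_; combine; splitAt; remQuot)
open import Data.Fin.Properties using (_≟_; any?; splitAt-↑ˡ; splitAt-↑ʳ; splitAt⁻¹-↑ˡ; splitAt⁻¹-↑ʳ; remQuot-combine; combine-remQuot; ↑ʳ-injective)
open import Data.Fin.Subset using (Subset; _∈_; _∉_; _⊆_; _∪_; ⁅_⁆; ⊤; ⊥; ∁; _-_; ∣_∣)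
open import Data.Fin.Subset.Properties using (_∈?_; ⊆-trans; ⊆-antisym; ⊆⊤; p⊆p∪q; q⊆p∪q; x∈⁅x⁆; ∣∁p∣≡n∸∣p∣; ∣⁅x⁆∣≡1; p⊆q⇒∣p∣≤∣q∣; x∈∁p⇒x∉p; ∣⊤∣≡n; x∈p∪q⁻; x∈⁅y⁆⇒x≡y; ∈⊤; ∣⊥∣≡0; x∉p⇒x∈∁p; x≢y⇒x∉⁅y⁆; x∈p∧x≢y⇒x∈p-y; x∈p⇒∣p-x∣<∣p∣)
open import Data.List using (List; []; _∷_; allFin; filter)
open import Data.List.Membership.Propositional using () renaming (_∈_ to _∈ₗ_)
open import Data.List.Relation.Unary.Any using (here; there)
open import Data.List.Membership.Propositional.Properties using (∈-allFin; ∈-filter⁺; ∈-filter⁻)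
open import Function using (_∘_)
open import Function.Bundles using (_⇔_; mk⇔; Equivalence)
open import Function.Construct.Identity using (↔-id)
open import Relation.Nullary using (¬_; yes; no; ¬?)
open import Relation.Nullary.Negation using (contradiction; ¬¬-map)
open import Relation.Binary.PropositionalEquality using (_≡_; _≢_; refl; sym; trans; cong; subst; subst₂; module ≡-Reasoning)
open import Relation.Binary.Construct.Closure.ReflexiveTransitive using (Star; ε; _◅_; _◅◅_)

module Forcing {n : ℕ} (G : Graph n) where

  -- The colour-change rule is applicable to v → w from the black set T,
  -- or w is already black (then the "force" is simply skipped).
  CanForce : Subset n → Fin n → Fin n → Set
  CanForce T v w =
    w ∈ T ⊎ (v ∈ T × Adj G v w × (∀ u → Adj G v u → u ≢ w → u ∈ T))

  CanForce-mono : ∀ {T T' v w} → T ⊆ T' → CanForce T v w → CanForce T' v w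
  CanForce-mono T⊆T' (inj₁ w∈T) = inj₁ (T⊆T' w∈T)
  CanForce-mono T⊆T' (inj₂ (v∈T , vw , others)) =
    inj₂ (T⊆T' v∈T , vw , λ u vu u≢w → T⊆T' (others u vu u≢w))

  Reaches : Subset n → (Fin n → Set) → Set
  Reaches T P = ∃[ T' ] (Star (ForceStep G) T T' × T ⊆ T' × (∀ {x} → P x → x ∈ T'))

  forceOne : ∀ {T v w} → CanForce T v w → Reaches T (_≡ w)
  forceOne {T} {v} {w} can with w ∈? T
  ... | yes w∈T = T , ε , (λ x∈T → x∈T) , λ { refl → w∈T }
  ... | no w∉T with can
  ...   | inj₁ w∈T = contradiction w∈T w∉T
  ...   | inj₂ (v∈T , vw , others) =
          T ∪ ⁅ w ⁆
          , (v , w , v∈T , w∉T , vw , others , refl) ◅ ε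
          , p⊆p∪q ⁅ w ⁆
          , λ { refl → q⊆p∪q T ⁅ w ⁆ (x∈⁅x⁆ w) }

  Reaches-weaken : ∀ {T P Q} → (∀ {x} → Q x → P x) → Reaches T P → Reaches T Q
  Reaches-weaken Q⇒P (T' , T⇝T' , T⊆T' , P⊆T') = T' , T⇝T' , T⊆T' , λ Qx → P⊆T' (Q⇒P Qx)

  infixl 5 _then_
  _then_ : ∀ {T P Q} → Reaches T P
         → (∀ {T'} → T ⊆ T' → (∀ {x} → P x → x ∈ T') → Reaches T' Q)
         → Reaches T (λ x → P x ⊎ Q x)
  (T₁ , T⇝T₁ , T⊆T₁ , P⊆T₁) then next with next T⊆T₁ P⊆T₁
  ... | T₂ , T₁⇝T₂ , T₁⊆T₂ , Q⊆T₂ =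
    T₂ , T⇝T₁ ◅◅ T₁⇝T₂ , ⊆-trans T⊆T₁ T₁⊆T₂
    , λ { (inj₁ Px) → T₁⊆T₂ (P⊆T₁ Px) ; (inj₂ Qx) → Q⊆T₂ Qx }

  Targets : ∀ {I : Set} → (I → Fin n) → List I → Fin n → Set
  Targets w is x = ∃[ i ] (i ∈ₗ is × x ≡ w i)

  -- A round of forces v i → w i (i ∈ is), each applicable to the initial set T,
  -- can be carried out one after another: applicability is monotone.
  forceAll : ∀ {I : Set} {T} (v w : I → Fin n) (is : List I)
           → (∀ {i} → i ∈ₗ is → CanForce T (v i) (w i))
           → Reaches T (Targets w is)
  forceAll {T = T} v w [] _ = T , ε , (λ x∈T → x∈T) , λ { (_ , () , _) }
  forceAll {T = T} v w (i ∷ is) can =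
    Reaches-weaken split (forceOne (can (here refl)) then remaining)
    where
    remaining : ∀ {T'} → T ⊆ T' → (∀ {x} → x ≡ w i → x ∈ T')
              → Reaches T' (Targets w is)
    remaining T⊆T' _ = forceAll v w is (λ j∈is → CanForce-mono T⊆T' (can (there j∈is)))
    split : ∀ {x} → Targets w (i ∷ is) x → x ≡ w i ⊎ Targets w is x
    split (j , here refl , x≡wj) = inj₁ x≡wj
    split (j , there j∈is , x≡wj) = inj₂ (j , j∈is , x≡wj)

  zeroForcing : ∀ {S P} → Reaches S P → (∀ x → x ∈ S ⊎ P x) → IsZeroForcingSet G S
  zeroForcing {S} (T , S⇝T , S⊆T , P⊆T) everything =
    subst (Star (ForceStep G) S) (⊆-antisym ⊆⊤ allBlack) S⇝T
    where
    allBlack : ⊤ ⊆ T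
    allBlack {x} _ with everything x
    ... | inj₁ x∈S = S⊆T x∈S
    ... | inj₂ Px  = P⊆T Px

  backwardInvariant : (P : Subset n → Set) → P ⊤
                    → (∀ {T T'} → ForceStep G T T' → P T' → P T)
                    → ∀ {S} → IsZeroForcingSet G S → P S
  backwardInvariant P P⊤ reflect ε = P⊤
  backwardInvariant P P⊤ reflect (force ◅ rest) = reflect force (backwardInvariant P P⊤ reflect rest)

∣++∣ : ∀ {m n} (p : Subset m) (q : Subset n) → ∣ p ++ q ∣ ≡ ∣ p ∣ + ∣ q ∣
∣++∣ []          q = refl
∣++∣ (true ∷ p)  q = cong suc (∣++∣ p q)
∣++∣ (false ∷ p) q = ∣++∣ p q

∣concat∣ : ∀ {m n} (ps : Vec (Subset n) m) → ∣ concat ps ∣ ≡ sum (map ∣_∣ ps)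
∣concat∣ []       = refl
∣concat∣ (p ∷ ps) = trans (∣++∣ p (concat ps)) (cong (∣ p ∣ +_) (∣concat∣ ps))

sum-lower : ∀ {A : Set} {m k} (f : A → ℕ) (xs : Vec A m)
          → (∀ i → k ≤ f (lookup xs i)) → m * k ≤ sum (map f xs)
sum-lower f []       _  = z≤n
sum-lower f (x ∷ xs) k≤ = +-mono-≤ (k≤ zero) (sum-lower f xs (k≤ ∘ suc))

sum-upper : ∀ {A : Set} {m k} (f : A → ℕ) (xs : Vec A m)
          → (∀ i → f (lookup xs i) ≤ k) → sum (map f xs) ≤ m * k
sum-upper f []       _  = z≤n
sum-upper f (x ∷ xs) ≤k = +-mono-≤ (≤k zero) (sum-upper f xs (≤k ∘ suc))

sum-upper-strict : ∀ {A : Set} {m k} (f : A → ℕ) (xs : Vec A m) (q : Fin m)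
                 → (∀ i → f (lookup xs i) ≤ k) → f (lookup xs q) < k → sum (map f xs) < m * k
sum-upper-strict f (x ∷ xs) zero    ≤k x<k  = +-mono-<-≤ x<k (sum-upper f xs (≤k ∘ suc))
sum-upper-strict f (x ∷ xs) (suc q) ≤k xq<k = +-mono-≤-< (≤k zero) (sum-upper-strict f xs q (≤k ∘ suc) xq<k)

x∉p∪⁅y⁆ : ∀ {n} {p : Subset n} {x y} → x ∉ p → x ≢ y → x ∉ p ∪ ⁅ y ⁆
x∉p∪⁅y⁆ {p = p} {y = y} x∉p x≢y x∈ with x∈p∪q⁻ p ⁅ y ⁆ x∈
... | inj₁ x∈p = x∉p x∈p
... | inj₂ x∈y = x≢y (x∈⁅y⁆⇒x≡y y x∈y)

∣∁⁅x⁆∣ : ∀ {n} (x : Fin n) → ∣ ∁ ⁅ x ⁆ ∣ ≡ n ∸ 1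
∣∁⁅x⁆∣ {n} x = trans (∣∁p∣≡n∸∣p∣ ⁅ x ⁆) (cong (n ∸_) (∣⁅x⁆∣≡1 x))

atMostOneMissing : ∀ {n} (p : Subset n) → (∀ x y → x ∉ p → y ∉ p → x ≡ y) → n ∸ 1 ≤ ∣ p ∣
atMostOneMissing {n} p unique with any? (λ x → ¬? (x ∈? p))
... | yes (x , x∉p) =
  subst (_≤ ∣ p ∣) (∣∁⁅x⁆∣ x) (p⊆q⇒∣p∣≤∣q∣ allButX)
  where
  allButX : ∁ ⁅ x ⁆ ⊆ p
  allButX {y} y∈∁x with y ∈? p
  ... | yes y∈p = y∈p
  ... | no y∉p with unique y x y∉p x∉p
  ...   | refl = contradiction (x∈⁅x⁆ x) (x∈∁p⇒x∉p y∈∁x)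
... | no nothingMissing =
  ≤-trans (m∸n≤m n 1) (subst (_≤ ∣ p ∣) (∣⊤∣≡n n) (p⊆q⇒∣p∣≤∣q∣ full))
  where
  full : ⊤ ⊆ p
  full {y} _ with y ∈? p
  ... | yes y∈p = y∈p
  ... | no y∉p  = contradiction (y , y∉p) nothingMissing

module Corona {N n₂ : ℕ} (B : Graph N) (H : Graph n₂) where

  center : Fin N → Fin (N + N * n₂)
  center i = i ↑ˡ (N * n₂)

  leaf : Fin N → Fin n₂ → Fin (N + N * n₂)
  leaf i h = N ↑ʳ combine i h

  data Vertex : Fin (N + N * n₂) → Set where
    isCenter : ∀ i → Vertex (center i)
    isLeaf   : ∀ i h → Vertex (leaf i h)

  vertex : ∀ x → Vertex x
  vertex x with splitAt N x in eq
  ... | inj₁ i = subst Vertex (splitAt⁻¹-↑ˡ eq) (isCenter i)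
  ... | inj₂ c = subst Vertex (trans (cong (N ↑ʳ_) (combine-remQuot {N} n₂ c)) (splitAt⁻¹-↑ʳ eq))
                   (isLeaf (proj₁ (remQuot {N} n₂ c)) (proj₂ (remQuot {N} n₂ c)))

  leaf-injective : ∀ {i h h'} → leaf i h ≡ leaf i h' → h ≡ h'
  leaf-injective {i} {h} {h'} eq =
    cong proj₂ (trans (sym (remQuot-combine i h))
               (trans (cong (remQuot n₂) (↑ʳ-injective N _ _ eq)) (remQuot-combine i h')))

  private
    G : Graph (N + N * n₂)
    G = B ⊙ H

  center-center : ∀ {i j} → Adj B i j → Adj G (center i) (center j)
  center-center {i} {j} ij rewrite splitAt-↑ˡ N i (N * n₂) | splitAt-↑ˡ N j (N * n₂) = ij

  spoke : ∀ i h → Adj G (center i) (leaf i h)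
  spoke i h rewrite splitAt-↑ˡ N i (N * n₂) | splitAt-↑ʳ N (N * n₂) (combine i h) =
    cong proj₁ (sym (remQuot-combine i h))

  private
    LeafAdj : Fin N × Fin n₂ → Fin N × Fin n₂ → Set
    LeafAdj (c , g) (d , h) = c ≡ d × Adj H g h

  leaf-leaf : ∀ {i g h} → Adj H g h → Adj G (leaf i g) (leaf i h)
  leaf-leaf {i} {g} {h} gh
    rewrite splitAt-↑ʳ N (N * n₂) (combine i g) | splitAt-↑ʳ N (N * n₂) (combine i h) =
    subst₂ LeafAdj (sym (remQuot-combine i g)) (sym (remQuot-combine i h)) (refl , gh)

  private
    center-center⁻ : ∀ {i j} → Adj G (center i) (center j) → Adj B i j
    center-center⁻ {i} {j} ij rewrite splitAt-↑ˡ N i (N * n₂) | splitAt-↑ˡ N j (N * n₂) = ij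

    spoke⁻ : ∀ {i j h} → Adj G (center i) (leaf j h) → i ≡ j
    spoke⁻ {i} {j} {h} a rewrite splitAt-↑ˡ N i (N * n₂) | splitAt-↑ʳ N (N * n₂) (combine j h) =
      trans a (cong proj₁ (remQuot-combine j h))

    leaf-leaf⁻ : ∀ {i j g h} → Adj G (leaf i g) (leaf j h) → i ≡ j × Adj H g h
    leaf-leaf⁻ {i} {j} {g} {h} a
      rewrite splitAt-↑ʳ N (N * n₂) (combine i g) | splitAt-↑ʳ N (N * n₂) (combine j h) =
      subst₂ LeafAdj (remQuot-combine i g) (remQuot-combine j h) a

  data CenterNeighbour (i : Fin N) : Fin (N + N * n₂) → Set where
    otherCenter : ∀ {j} → Adj B i j → CenterNeighbour i (center j)
    ownLeaf     : ∀ h → CenterNeighbour i (leaf i h)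

  centerNeighbour : ∀ {i u} → Adj G (center i) u → CenterNeighbour i u
  centerNeighbour {i} {u} iu with vertex u
  ... | isCenter j = otherCenter (center-center⁻ iu)
  ... | isLeaf j h with spoke⁻ iu
  ...   | refl = ownLeaf h

  data LeafNeighbour (i : Fin N) (g : Fin n₂) : Fin (N + N * n₂) → Set where
    ownCenter : LeafNeighbour i g (center i)
    sameCopy  : ∀ {h} → Adj H g h → LeafNeighbour i g (leaf i h)

  leafNeighbour : ∀ {i g u} → Adj G (leaf i g) u → LeafNeighbour i g u
  leafNeighbour {i} {g} {u} gu with vertex u
  ... | isCenter j with spoke⁻ (sym' G gu)
  ...   | refl = ownCenter
  leafNeighbour gu | isLeaf j h with leaf-leaf⁻ gu
  ...   | refl , gh = sameCopy gh

  coronaSet : Subset N → Vec (Subset n₂) N → Subset (N + N * n₂)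
  coronaSet c ls = c ++ concat ls

  decompose : ∀ S → ∃[ c ] ∃[ ls ] (S ≡ coronaSet c ls)
  decompose S with Data.Vec.splitAt N S
  ... | c , rest , refl with Data.Vec.group N n₂ rest
  ...   | ls , refl = c , ls , refl

  private
    lookup-leaf : ∀ c ls i h → lookup (coronaSet c ls) (leaf i h) ≡ lookup (lookup ls i) h
    lookup-leaf c ls i h = trans (lookup-++ʳ c (concat ls) (combine i h)) (lookup-concat ls i h)

  leaf∈⁺ : ∀ {c ls i h} → h ∈ lookup ls i → leaf i h ∈ coronaSet c ls
  leaf∈⁺ {c} {ls} {i} {h} h∈ =
    lookup⇒[]= (leaf i h) _ (trans (lookup-leaf c ls i h) ([]=⇒lookup h∈))

  leaf∈⁻ : ∀ {c ls i h} → leaf i h ∈ coronaSet c ls → h ∈ lookup ls i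
  leaf∈⁻ {c} {ls} {i} {h} x∈ =
    lookup⇒[]= h _ (trans (sym (lookup-leaf c ls i h)) ([]=⇒lookup x∈))

  ∣coronaSet∣ : ∀ c ls → ∣ coronaSet c ls ∣ ≡ ∣ c ∣ + sum (map ∣_∣ ls)
  ∣coronaSet∣ c ls = trans (∣++∣ c (concat ls)) (cong (∣ c ∣ +_) (∣concat∣ ls))

  ∣leavesOnly∣ : ∀ ls → ∣ coronaSet ⊥ ls ∣ ≡ sum (map ∣_∣ ls)
  ∣leavesOnly∣ ls = trans (∣coronaSet∣ ⊥ ls) (cong (_+ sum (map ∣_∣ ls)) (∣⊥∣≡0 N))

  module Edgeless (noEdge : ∀ g h → ¬ Adj H g h) where
    open Forcing G

    -- Invariant for the lower bound: each copy of H has at most one white leaf.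
    OneWhiteLeaf : Subset (N + N * n₂) → Set
    OneWhiteLeaf T = ∀ i h h' → leaf i h ∉ T → leaf i h' ∉ T → h ≡ h'

    onlyNeighbour : ∀ {i g u} → Adj G (leaf i g) u → u ≡ center i
    onlyNeighbour {g = g} a with leafNeighbour a
    ... | ownCenter  = refl
    ... | sameCopy {h} gh = contradiction gh (noEdge g h)

    -- A leaf can only be forced by its centre; at that moment it is the only
    -- white leaf of its copy, since all other leaves are neighbours of the centre.
    forcedLeafAlone : ∀ {T v i g g'} → Adj G v (leaf i g)
                    → (∀ u → Adj G v u → u ≢ leaf i g → u ∈ T)
                    → leaf i g' ∉ T → g ≡ g'
    forcedLeafAlone {i = i} {g} {g'} vw others g'∉T with onlyNeighbour (sym' G vw)
    ... | refl with leaf i g' ≟ leaf i g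
    ...   | yes same = sym (leaf-injective same)
    ...   | no other = contradiction (others (leaf i g') (spoke i g') other) g'∉T

    OneWhiteLeaf-reflected : ∀ {T T'} → ForceStep G T T' → OneWhiteLeaf T' → OneWhiteLeaf T
    OneWhiteLeaf-reflected {T} (v , w , _ , _ , vw , others , refl) inv i h h' h∉T h'∉T
      with leaf i h ≟ w | leaf i h' ≟ w
    ... | yes refl | _        = forcedLeafAlone vw others h'∉T
    ... | no _     | yes refl = sym (forcedLeafAlone vw others h∉T)
    ... | no h≢w   | no h'≢w  = inv i h h' (x∉p∪⁅y⁆ h∉T h≢w) (x∉p∪⁅y⁆ h'∉T h'≢w)

    lowerBound : ∀ S → IsZeroForcingSet G S → N * (n₂ ∸ 1) ≤ ∣ S ∣
    lowerBound S zfs with decompose S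
    ... | c , ls , refl = begin
        N * (n₂ ∸ 1)              ≤⟨ sum-lower ∣_∣ ls perCopy ⟩
        sum (map ∣_∣ ls)          ≤⟨ m≤n+m _ ∣ c ∣ ⟩
        ∣ c ∣ + sum (map ∣_∣ ls)  ≡⟨ ∣coronaSet∣ c ls ⟨
        ∣ coronaSet c ls ∣        ∎
      where
      open ≤-Reasoning
      inv : OneWhiteLeaf (coronaSet c ls)
      inv = backwardInvariant OneWhiteLeaf (λ i h h' h∉⊤ _ → contradiction ∈⊤ h∉⊤)
                              OneWhiteLeaf-reflected zfs
      perCopy : ∀ i → n₂ ∸ 1 ≤ ∣ lookup ls i ∣
      perCopy i = atMostOneMissing (lookup ls i) λ x y x∉ y∉ →
        inv i x y (x∉ ∘ leaf∈⁻ {c} {ls}) (y∉ ∘ leaf∈⁻ {c} {ls})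

    -- Upper bound: blacken every leaf except leaf h₀ of each copy.  A leaf h₁
    -- of copy i forces centre i, after which centre i forces leaf h₀ of copy i.
    module _ (h₀ h₁ : Fin n₂) (h₁≢h₀ : h₁ ≢ h₀) where

      allButOne : Subset (N + N * n₂)
      allButOne = coronaSet ⊥ (replicate N (∁ ⁅ h₀ ⁆))

      inAllButOne : ∀ {i h} → h ≢ h₀ → leaf i h ∈ allButOne
      inAllButOne {i} {h} h≢h₀ = leaf∈⁺ {⊥} {replicate N (∁ ⁅ h₀ ⁆)}
        (subst (h ∈_) (sym (lookup-replicate i (∁ ⁅ h₀ ⁆))) (x∉p⇒x∈∁p (x≢y⇒x∉⁅y⁆ h≢h₀)))

      leafForcesCenter : ∀ i → CanForce allButOne (leaf i h₁) (center i)
      leafForcesCenter i = inj₂ (inAllButOne h₁≢h₀ , sym' G (spoke i h₁) , onlyCenter)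
        where
        onlyCenter : ∀ u → Adj G (leaf i h₁) u → u ≢ center i → u ∈ allButOne
        onlyCenter u a u≢center = contradiction (onlyNeighbour a) u≢center

      centerForcesLeaf : ∀ {T} → allButOne ⊆ T → (∀ j → center j ∈ T)
                       → ∀ i → CanForce T (center i) (leaf i h₀)
      centerForcesLeaf {T} ⊆T centers i = inj₂ (centers i , spoke i h₀ , othersBlack)
        where
        othersBlack : ∀ u → Adj G (center i) u → u ≢ leaf i h₀ → u ∈ T
        othersBlack u a u≢leaf with centerNeighbour a
        ... | otherCenter {j} _ = centers j
        ... | ownLeaf h = ⊆T (inAllButOne λ { refl → u≢leaf refl })

      allButOne-forces : IsZeroForcingSet G allButOne
      allButOne-forces = zeroForcing
        (forceAll (λ i → leaf i h₁) center (allFin N) (λ {i} _ → leafForcesCenter i)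
         then λ S⊆T centers⊆T →
         forceAll center (λ i → leaf i h₀) (allFin N)
           (λ {i} _ → centerForcesLeaf S⊆T (λ j → centers⊆T (j , ∈-allFin j , refl)) i))
        covered
        where
        covered : ∀ x → x ∈ allButOne
                      ⊎ (Targets center (allFin N) x ⊎ Targets (λ i → leaf i h₀) (allFin N) x)
        covered x with vertex x
        ... | isCenter i = inj₂ (inj₁ (i , ∈-allFin i , refl))
        ... | isLeaf i h with h ≟ h₀
        ...   | yes refl  = inj₂ (inj₂ (i , ∈-allFin i , refl))
        ...   | no h≢h₀   = inj₁ (inAllButOne h≢h₀)

      ∣allButOne∣ : ∣ allButOne ∣ ≤ N * (n₂ ∸ 1)
      ∣allButOne∣ = subst (_≤ N * (n₂ ∸ 1)) (sym (∣leavesOnly∣ copies)) (sum-upper ∣_∣ copies eachCopy)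
        where
        copies : Vec (Subset n₂) N
        copies = replicate N (∁ ⁅ h₀ ⁆)
        eachCopy : ∀ i → ∣ lookup copies i ∣ ≤ n₂ ∸ 1
        eachCopy i = ≤-reflexive (trans (cong ∣_∣ (lookup-replicate i (∁ ⁅ h₀ ⁆))) (∣∁⁅x⁆∣ h₀))

      Z-edgeless : IsZ G (N * (n₂ ∸ 1))
      Z-edgeless = (allButOne , allButOne-forces , ≤-antisym ∣allButOne∣ (lowerBound _ allButOne-forces))
                 , lowerBound

  -- If B has an edge p q, and H has an edge a b and a vertex y ≠ a not adjacent
  -- to a, then B ⊙ H has a zero forcing set with fewer than N (n₂ ∸ 1) vertices:
  -- copies i ≠ q miss only leaf a, and copy q misses only leaves b and y.
  module NotEdgeless {p q : Fin N} (pq : Adj B p q)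
                     {a b y : Fin n₂} (ab : Adj H a b) (y≢a : y ≢ a) (a≁y : ¬ Adj H a y) where
    open Forcing G

    private
      b≢a : b ≢ a
      b≢a refl = irrefl H ab
      y≢b : y ≢ b
      y≢b refl = a≁y ab

    copies : Vec (Subset n₂) N
    copies = replicate N (∁ ⁅ a ⁆) [ q ]≔ (∁ ⁅ b ⁆ - y)

    S₀ : Subset (N + N * n₂)
    S₀ = coronaSet ⊥ copies

    copy-other : ∀ {i} → i ≢ q → lookup copies i ≡ ∁ ⁅ a ⁆
    copy-other {i} i≢q =
      trans (lookup∘update′ i≢q (replicate N (∁ ⁅ a ⁆)) (∁ ⁅ b ⁆ - y)) (lookup-replicate i (∁ ⁅ a ⁆))

    copy-q : lookup copies q ≡ ∁ ⁅ b ⁆ - y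
    copy-q = lookup∘update q (replicate N (∁ ⁅ a ⁆)) (∁ ⁅ b ⁆ - y)

    inOtherCopy : ∀ {i h} → i ≢ q → h ≢ a → leaf i h ∈ S₀
    inOtherCopy {i} {h} i≢q h≢a = leaf∈⁺ {⊥} {copies}
      (subst (h ∈_) (sym (copy-other i≢q)) (x∉p⇒x∈∁p (x≢y⇒x∉⁅y⁆ h≢a)))

    inCopyQ : ∀ {h} → h ≢ b → h ≢ y → leaf q h ∈ S₀
    inCopyQ {h} h≢b h≢y = leaf∈⁺ {⊥} {copies}
      (subst (h ∈_) (sym copy-q) (x∈p∧x≢y⇒x∈p-y (x∉p⇒x∈∁p (x≢y⇒x∉⁅y⁆ h≢b)) h≢y))

    others : List (Fin N)
    others = filter (λ i → ¬? (i ≟ q)) (allFin N)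

    other : ∀ {i} → i ≢ q → i ∈ₗ others
    other {i} i≢q = ∈-filter⁺ (λ j → ¬? (j ≟ q)) {xs = allFin N} (∈-allFin i) i≢q

    other⁻ : ∀ {i} → i ∈ₗ others → i ≢ q
    other⁻ i∈ = proj₂ (∈-filter⁻ (λ j → ¬? (j ≟ q)) {xs = allFin N} i∈)

    -- Round 1: in each copy i ≠ q, leaf y forces centre i (its other
    -- neighbours are H-neighbours of y, which differ from a).
    yForcesCenter : ∀ {i} → i ∈ₗ others → CanForce S₀ (leaf i y) (center i)
    yForcesCenter {i} i∈ = inj₂ (inOtherCopy (other⁻ i∈) y≢a , sym' G (spoke i y) , othersBlack)
      where
      othersBlack : ∀ u → Adj G (leaf i y) u → u ≢ center i → u ∈ S₀
      othersBlack u yu u≢center with leafNeighbour yu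
      ... | ownCenter   = contradiction refl u≢center
      ... | sameCopy yh = inOtherCopy (other⁻ i∈) λ { refl → a≁y (sym' H yh) }

    bForcesA : ∀ {T} → S₀ ⊆ T → (∀ {i} → i ≢ q → center i ∈ T)
             → ∀ {i} → i ∈ₗ others → CanForce T (leaf i b) (leaf i a)
    bForcesA {T} S₀⊆T centers {i} i∈ =
      inj₂ (S₀⊆T (inOtherCopy (other⁻ i∈) b≢a) , leaf-leaf (sym' H ab) , othersBlack)
      where
      othersBlack : ∀ u → Adj G (leaf i b) u → u ≢ leaf i a → u ∈ T
      othersBlack u bu u≢a with leafNeighbour bu
      ... | ownCenter  = centers (other⁻ i∈)
      ... | sameCopy _ = S₀⊆T (inOtherCopy (other⁻ i∈) λ { refl → u≢a refl })

    -- Step 3: centre p, whose neighbourhood is now black except centre q, forces it.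
    pForcesQ : ∀ {T} → S₀ ⊆ T → (∀ {i} → i ≢ q → center i ∈ T) → (∀ {i} → i ≢ q → leaf i a ∈ T)
             → CanForce T (center p) (center q)
    pForcesQ {T} S₀⊆T centers leavesA = inj₂ (centers p≢q , center-center pq , othersBlack)
      where
      p≢q : p ≢ q
      p≢q refl = irrefl B pq
      othersBlack : ∀ u → Adj G (center p) u → u ≢ center q → u ∈ T
      othersBlack u pu u≢q with centerNeighbour pu
      ... | otherCenter _ = centers λ { refl → u≢q refl }
      ... | ownLeaf h with h ≟ a
      ...   | yes refl = leavesA p≢q
      ...   | no h≢a   = S₀⊆T (inOtherCopy p≢q h≢a)

    -- Step 4: in copy q, leaf a forces leaf b (y is not a neighbour of a).
    aForcesB : ∀ {T} → S₀ ⊆ T → center q ∈ T → CanForce T (leaf q a) (leaf q b)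
    aForcesB {T} S₀⊆T q∈T =
      inj₂ (S₀⊆T (inCopyQ (b≢a ∘ sym) (y≢a ∘ sym)) , leaf-leaf ab , othersBlack)
      where
      othersBlack : ∀ u → Adj G (leaf q a) u → u ≢ leaf q b → u ∈ T
      othersBlack u au u≢b with leafNeighbour au
      ... | ownCenter   = q∈T
      ... | sameCopy ah = S₀⊆T (inCopyQ (λ { refl → u≢b refl }) λ { refl → a≁y ah })

    qForcesY : ∀ {T} → S₀ ⊆ T → (∀ {i} → i ≢ q → center i ∈ T) → center q ∈ T → leaf q b ∈ T
             → CanForce T (center q) (leaf q y)
    qForcesY {T} S₀⊆T centers q∈T b∈T = inj₂ (q∈T , spoke q y , othersBlack)
      where
      othersBlack : ∀ u → Adj G (center q) u → u ≢ leaf q y → u ∈ T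
      othersBlack u qu u≢y with centerNeighbour qu
      ... | otherCenter qj = centers λ { refl → irrefl B qj }
      ... | ownLeaf h with h ≟ b
      ...   | yes refl = b∈T
      ...   | no h≢b   = S₀⊆T (inCopyQ h≢b λ { refl → u≢y refl })

    S₀-forces : IsZeroForcingSet G S₀
    S₀-forces = zeroForcing
      (forceAll (λ i → leaf i y) center others yForcesCenter
       then (λ S₀⊆T done → forceAll (λ i → leaf i b) (λ i → leaf i a) others
                             (bForcesA S₀⊆T (λ i≢q → done (hit i≢q))))
       then (λ S₀⊆T done → forceOne (pForcesQ S₀⊆T (λ i≢q → done (inj₁ (hit i≢q)))
                                                    (λ i≢q → done (inj₂ (hit i≢q)))))
       then (λ S₀⊆T done → forceOne (aForcesB S₀⊆T (done (inj₂ refl))))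
       then (λ S₀⊆T done → forceOne (qForcesY S₀⊆T (λ i≢q → done (inj₁ (inj₁ (inj₁ (hit i≢q)))))
                                                    (done (inj₁ (inj₂ refl))) (done (inj₂ refl)))))
      covered
      where
      hit : ∀ {w : Fin N → Fin (N + N * n₂)} {i} → i ≢ q → Targets w others (w i)
      hit {i = i} i≢q = i , other i≢q , refl
      covered : ∀ x → x ∈ S₀
        ⊎ ((((Targets center others x ⊎ Targets (λ i → leaf i a) others x)
             ⊎ x ≡ center q) ⊎ x ≡ leaf q b) ⊎ x ≡ leaf q y)
      covered x with vertex x
      ... | isCenter i with i ≟ q
      ...   | yes refl = inj₂ (inj₁ (inj₁ (inj₂ refl)))
      ...   | no i≢q   = inj₂ (inj₁ (inj₁ (inj₁ (inj₁ (hit i≢q)))))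
      covered x | isLeaf i h with i ≟ q | h ≟ a | h ≟ b | h ≟ y
      ... | yes refl | _        | yes refl | _        = inj₂ (inj₁ (inj₂ refl))
      ... | yes refl | _        | no _     | yes refl = inj₂ (inj₂ refl)
      ... | yes refl | _        | no h≢b   | no h≢y   = inj₁ (inCopyQ h≢b h≢y)
      ... | no i≢q   | yes refl | _        | _        = inj₂ (inj₁ (inj₁ (inj₁ (inj₂ (hit i≢q)))))
      ... | no i≢q   | no h≢a   | _        | _        = inj₁ (inOtherCopy i≢q h≢a)

    ∣copy-q∣ : ∣ lookup copies q ∣ < n₂ ∸ 1
    ∣copy-q∣ = subst₂ (λ c m → ∣ c ∣ < m) (sym copy-q) (∣∁⁅x⁆∣ b)
                      (x∈p⇒∣p-x∣<∣p∣ (x∉p⇒x∈∁p (x≢y⇒x∉⁅y⁆ y≢b)))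

    ∣copy∣ : ∀ i → ∣ lookup copies i ∣ ≤ n₂ ∸ 1
    ∣copy∣ i with i ≟ q
    ... | yes refl = <⇒≤ ∣copy-q∣
    ... | no i≢q   = ≤-reflexive (trans (cong ∣_∣ (copy-other i≢q)) (∣∁⁅x⁆∣ a))

    smallerForcingSet : ∃[ S ] (IsZeroForcingSet G S × ∣ S ∣ < N * (n₂ ∸ 1))
    smallerForcingSet = S₀ , S₀-forces
      , subst (_< N * (n₂ ∸ 1)) (sym (∣leavesOnly∣ copies)) (sum-upper-strict ∣_∣ copies q ∣copy∣ ∣copy-q∣)

HasEdge : ∀ {n} → Graph n → Set
HasEdge G = ∃[ i ] ∃[ j ] Adj G i j

-- A connected graph with at least two vertices has an edge: the first step
-- of a walk between two distinct vertices.
connected⇒edge : ∀ {n} (G : Graph (suc (suc n))) → Connected G → HasEdge G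
connected⇒edge G conn with conn zero (suc zero)
... | step {j = j} e _ = zero , j , e

-- The centres of B ⊙^k H induce a copy of B, so edges of B survive.
coronaPower-edge : ∀ {n₁ n₂} {B : Graph n₁} (H : Graph n₂) → HasEdge B → ∀ k → HasEdge (B ⊙^ k ∙ H)
coronaPower-edge H edge zero = edge
coronaPower-edge {B = B} H edge (suc k) with coronaPower-edge H edge k
... | i , j , ij = center i , center j , center-center ij
  where open Corona (B ⊙^ k ∙ H) H

coronaOrder-closed : ∀ n₁ n₂ k → coronaOrder n₁ n₂ k ≡ n₁ * suc n₂ ^ k
coronaOrder-closed n₁ n₂ zero = sym (*-identityʳ n₁)
coronaOrder-closed n₁ n₂ (suc k) = begin
  coronaOrder n₁ n₂ k + coronaOrder n₁ n₂ k * n₂ ≡⟨ *-suc (coronaOrder n₁ n₂ k) n₂ ⟨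
  coronaOrder n₁ n₂ k * suc n₂                   ≡⟨ cong (_* suc n₂) (coronaOrder-closed n₁ n₂ k) ⟩
  n₁ * suc n₂ ^ k * suc n₂                       ≡⟨ *-assoc n₁ (suc n₂ ^ k) (suc n₂) ⟩
  n₁ * (suc n₂ ^ k * suc n₂)                     ≡⟨ cong (n₁ *_) (*-comm (suc n₂ ^ k) (suc n₂)) ⟩
  n₁ * suc n₂ ^ suc k                            ∎
  where open ≡-Reasoning

dominating⇒connected : ∀ {n} (H : Graph n) a → (∀ y → y ≢ a → Adj H a y) → Connected H
dominating⇒connected H a dominating i j = joinWalks (toA i) (fromA j)
  where
  fromA : ∀ j → Walk H a j
  fromA j with j ≟ a
  ... | yes refl = here
  ... | no j≢a   = step (dominating j j≢a) here
  toA : ∀ i → Walk H i a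
  toA i with i ≟ a
  ... | yes refl = here
  ... | no i≢a   = step (sym' H (dominating i i≢a)) here
  joinWalks : ∀ {i j} → Walk H i a → Walk H a j → Walk H i j
  joinWalks here         w = w
  joinWalks (step e rest) w = step e (joinWalks rest w)

¬¬-∀-Fin : ∀ n {P : Fin n → Set} → (∀ i → ¬ ¬ P i) → ¬ ¬ (∀ i → P i)
¬¬-∀-Fin zero    _     none = none λ ()
¬¬-∀-Fin (suc n) ¬¬P none =
  ¬¬P zero λ P0 → ¬¬-∀-Fin n (¬¬P ∘ suc) λ Psuc → none λ { zero → P0 ; (suc i) → Psuc i }

-- In a disconnected graph no vertex a is adjacent to all others; in the form
-- used below: it is impossible that no vertex y ≠ a is non-adjacent to a.
notDominating : ∀ {n} (H : Graph n) → Disconnected H → ∀ a → ¬ (∀ y → y ≢ a → ¬ ¬ Adj H a y)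
notDominating {n} H disc a almost =
  ¬¬-∀-Fin n ¬¬dominates (λ dominating → disc (dominating⇒connected H a dominating))
  where
  ¬¬dominates : ∀ y → ¬ ¬ (y ≢ a → Adj H a y)
  ¬¬dominates y with y ≟ a
  ... | yes y≡a = λ ¬P → ¬P λ y≢a → contradiction y≡a y≢a
  ... | no y≢a  = ¬¬-map (λ ay _ → ay) (almost y y≢a)

noEdges⇒≅edgeless : ∀ {n} (H : Graph n) → (∀ g h → ¬ Adj H g h) → H ≅ edgeless n
noEdges⇒≅edgeless H noEdge = ↔-id _ , λ g h → noEdge g h , λ ()

≅edgeless⇒noEdges : ∀ {n} (H : Graph n) → H ≅ edgeless n → ∀ g h → ¬ Adj H g h
≅edgeless⇒noEdges H (_ , preserves) g h = proj₁ (preserves g h)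

edgeless⇒Z-corona : ∀ {N m} (B : Graph N) (H : Graph (suc (suc m)))
                  → H ≅ edgeless (suc (suc m)) → IsZ (B ⊙ H) (N * suc m)
edgeless⇒Z-corona B H iso =
  Corona.Edgeless.Z-edgeless B H (≅edgeless⇒noEdges H iso) zero (suc zero) (λ ())

-- For B with an edge and disconnected H on at least two vertices, the value
-- Z(B ⊙ H) = |B| (|H| ∸ 1) is attained exactly when H is edgeless: otherwise
-- H has an edge a b and (being disconnected) a vertex y ≠ a not adjacent to a.
Z-corona⇔edgeless : ∀ {N m} (B : Graph N) (H : Graph (suc (suc m)))
                  → HasEdge B → Disconnected H
                  → IsZ (B ⊙ H) (N * suc m) ⇔ (H ≅ edgeless (suc (suc m)))
Z-corona⇔edgeless {N} {m} B H (p , q , pq) disc = mk⇔ onlyIf (edgeless⇒Z-corona B H)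
  where
  onlyIf : IsZ (B ⊙ H) (N * suc m) → H ≅ edgeless (suc (suc m))
  onlyIf (_ , minimal) = noEdges⇒≅edgeless H λ a b ab →
    notDominating H disc a λ y y≢a a≁y →
      let S , S-forces , S-small = Corona.NotEdgeless.smallerForcingSet B H pq ab y≢a a≁y
      in <⇒≱ S-small (minimal S S-forces)

mainTheorem13 : ∀ {n₁ n₂} (G : Graph n₁) (H : Graph n₂) (k : ℕ)
    → 2 ≤ n₁ → 2 ≤ n₂ → 1 ≤ k
    → Connected G → Disconnected H
    → (IsZ (G ⊙^ k ∙ H) (n₁ * suc n₂ ^ (k ∸ 1) * (n₂ ∸ 1))
    × IsZ (K₁ ⊙ H) (n₂ ∸ 1))
    ⇔ (H ≅ edgeless n₂)
mainTheorem13 {suc (suc l)} {suc (suc m)} G H (suc k) (s≤s (s≤s z≤n)) (s≤s (s≤s z≤n)) (s≤s z≤n) conn disc =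
  mk⇔ (λ (Z-power , _) → Equivalence.to Z-power⇔edgeless (subst (IsZ (G ⊙^ suc k ∙ H)) value Z-power))
      (λ iso → subst (IsZ (G ⊙^ suc k ∙ H)) (sym value) (Equivalence.from Z-power⇔edgeless iso)
             , subst (IsZ (K₁ ⊙ H)) (*-identityˡ (suc m)) (edgeless⇒Z-corona K₁ H iso))
  where
  -- G ⊙^(k+1) H = (G ⊙^k H) ⊙ H, and G ⊙^k H has an edge and n₁ (n₂ + 1)^k vertices.
  Z-power⇔edgeless : IsZ (G ⊙^ suc k ∙ H) (coronaOrder (suc (suc l)) (suc (suc m)) k * suc m)
                   ⇔ (H ≅ edgeless (suc (suc m)))
  Z-power⇔edgeless = Z-corona⇔edgeless (G ⊙^ k ∙ H) H (coronaPower-edge H (connected⇒edge G conn) k) disc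
  value : suc (suc l) * suc (suc (suc m)) ^ k * suc m ≡ coronaOrder (suc (suc l)) (suc (suc m)) k * suc m
  value = cong (_* suc m) (sym (coronaOrder-closed (suc (suc l)) (suc (suc m)) k))
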